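{- On instances with a uniform deadline (i.e. $d_j=d$ for all jobs $j$), LLF is $1$-competitive for preemptive semi-online machine minimization; that is, LLF run on $m$ machines produces a feasible schedule, where $m$ is the optimal number of machines.
   Context: Machine minimization with deadlines: each job $j$ of a finite instance has integer release date $r_j$, processing time $p_j$ and deadline $d_j$. A feasible preemptive schedule on a given number of identical machines processes each job for $p_j$ units within $[r_j,d_j]$, each machine processing at most one job at a time, no job on two machines at once; preemption and migration allowed. $m$ is the minimum number of machines admitting a feasible schedule. Semi-online: jobs become known at their release dates and $m$ is known in advance. For an algorithm, $p_j(t)$ is the remaining processing time of $j$ at time $t$ and its laxity is $\ell_j(t)=d_j-t-p_j(t)$. Least Laxity First (LLF) on $k$ machines makes decisions at integer times and at each time processes the $k$ released, unfinished jobs with smallest non-negative laxity, ties broken in favor of earlier release date, then smaller index. -}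

module Defs where

open import Data.Nat.Base using (ℕ; zero; suc; _+_; _∸_; _≤_; _<_; _<ᵇ_; _≡ᵇ_; _≤ᵇ_)
open import Data.Bool.Base using (Bool; true; false; if_then_else_; _∧_; _∨_)
open import Data.Fin.Base using (Fin; toℕ) renaming (zero to fz; suc to fs)
open import Relation.Binary.PropositionalEquality using (_≡_)
open import Data.Product using (_×_; Σ; ∃)

record Job : Set where
  constructor job
  field
    r : ℕ
    p : ℕ
    d : ℕ
open Job public

Instance : ℕ → Set
Instance n = Fin n → Job

countFin : (n : ℕ) → (Fin n → Bool) → ℕ
countFin zero    f = 0
countFin (suc n) f = (if f fz then 1 else 0) + countFin n (λ j → f (fs j))

countBelow : ℕ → (ℕ → Bool) → ℕ
countBelow zero    f = 0
countBelow (suc T) f = countBelow T f + (if f T then 1 else 0)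

-- A (discretised) schedule: S t j = true iff job j is processed during the
-- unit time slot [t, t+1).
Schedule : ℕ → Set
Schedule n = ℕ → Fin n → Bool

-- Feasible preemptive schedule on k identical machines (migration allowed):
-- at most k jobs run in each slot, a job is run (on one machine) only inside
-- [r_j, d_j], and each job receives exactly p_j units of processing.
record Feasible {n : ℕ} (I : Instance n) (k : ℕ) (S : Schedule n) : Set where
  field
    capacity : ∀ t → countFin n (S t) ≤ k
    window   : ∀ t j → S t j ≡ true → r (I j) ≤ t × t < d (I j)
    amount   : ∀ j → countBelow (d (I j)) (λ t → S t j) ≡ p (I j)

FeasibleOn : {n : ℕ} → Instance n → ℕ → Set
FeasibleOn {n} I k = Σ (Schedule n) (Feasible I k)

IsOptimal : {n : ℕ} → Instance n → ℕ → Set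
IsOptimal I m = FeasibleOn I m × (∀ k → FeasibleOn I k → m ≤ k)

UniformDeadline : {n : ℕ} → Instance n → Set
UniformDeadline {n} I = ∃ λ d₀ → ∀ (j : Fin n) → d (I j) ≡ d₀

-- j is available at time t: released, unfinished, non-negative laxity
-- (laxity d_j - t - p_j(t) ≥ 0  ⇔  t + p_j(t) ≤ d_j)
available : {n : ℕ} → Instance n → ℕ → (Fin n → ℕ) → Fin n → Bool
available I t rem j = (r (I j) ≤ᵇ t) ∧ ((1 ≤ᵇ rem j) ∧ ((t + rem j) ≤ᵇ d (I j)))

-- laxity (meaningful for available jobs, where it is non-negative)
laxity : {n : ℕ} → Instance n → ℕ → (Fin n → ℕ) → Fin n → ℕ
laxity I t rem j = d (I j) ∸ (t + rem j)

precedes : {n : ℕ} → Instance n → ℕ → (Fin n → ℕ) → Fin n → Fin n → Bool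
precedes I t rem i j =
  (laxity I t rem i <ᵇ laxity I t rem j)
  ∨ ((laxity I t rem i ≡ᵇ laxity I t rem j)
     ∧ ((r (I i) <ᵇ r (I j))
        ∨ ((r (I i) ≡ᵇ r (I j)) ∧ (toℕ i <ᵇ toℕ j))))

-- LLF processes j at time t iff j is available and fewer than k available
-- jobs precede it, i.e. j is among the k available jobs of highest priority
select : {n : ℕ} → Instance n → ℕ → ℕ → (Fin n → ℕ) → Fin n → Bool
select {n} I k t rem j =
  available I t rem j ∧ (countFin n (λ i → available I t rem i ∧ precedes I t rem i j) <ᵇ k)

llfRem : {n : ℕ} → Instance n → ℕ → ℕ → Fin n → ℕ
llfRem I k zero    j = p (I j)
llfRem I k (suc t) j =
  llfRem I k t j ∸ (if select I k t (llfRem I k t) j then 1 else 0)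

llf : {n : ℕ} → Instance n → ℕ → Schedule n
llf I k t j = select I k t (llfRem I k t) j

-- Compare LLF with a feasible schedule S on m machines through the truncated
-- workloads W_h(t) = Σ_j max(0, rem_j(t) − h), and show by induction on t
-- that for every level h the workload of LLF never exceeds that of S.  With a
-- common deadline D the laxity order is the reverse of the remaining-work
-- order, so in each slot LLF either serves m jobs above level h (S serves at
-- most m), or serves every available job above h; the unavailable jobs above
-- h are then unreleased, so S cannot have served them either.  The invariant
-- at level D − t says that LLF never lets a laxity become negative, and at
-- level 0 and time D that LLF completes every job.
module Submission where

open import Defs
open import Data.Bool.Base using (Bool; true; false; T; not; _∧_; _∨_; if_then_else_)
open import Data.Bool.Properties using (T-∧; T-∨; T-≡)
open import Data.Empty using (⊥-elim)
open import Data.Fin.Base using (Fin; toℕ) renaming (zero to fz; suc to fs)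
open import Data.Fin.Properties using (toℕ-injective) renaming (_≟_ to _≟ᶠ_)
open import Data.Nat.Base
  using (ℕ; zero; suc; _+_; _∸_; _≤_; _<_; _<ᵇ_; _≡ᵇ_; _≤ᵇ_; z≤n; s≤s)
open import Data.Nat.Properties
open import Algebra.Properties.CommutativeMonoid.Sum +-0-commutativeMonoid
  using (sum; sum-cong-≗; sum-replicate-zero; ∑-distrib-+)
open import Algebra.Properties.CommutativeSemigroup +-commutativeSemigroup
  using (xy∙z≈xz∙y)
open import Data.Product using (_×_; _,_; ∃; proj₁; proj₂)
open import Data.Product.Function.NonDependent.Propositional using (_×-⇔_)
open import Data.Product.Relation.Binary.Lex.Strict using (×-Lex; ×-isStrictTotalOrder)
open import Data.Product.Relation.Binary.Pointwise.NonDependent using (Pointwise)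
open import Data.Sum using (_⊎_; inj₁; inj₂)
open import Data.Sum.Function.Propositional using (_⊎-⇔_)
open import Data.Unit using (tt)
open import Function.Base using (_∘_; _⟨_⟩_)
open import Function.Bundles using (_⇔_; mk⇔; Equivalence)
open import Function.Properties.Equivalence using () renaming (trans to ⇔-trans)
open import Relation.Binary.Definitions using (tri<; tri≈; tri>)
open import Relation.Binary.Structures using (IsTotalPreorder; IsStrictTotalOrder)
import Relation.Binary.Construct.Flip.EqAndOrd as Flip
open import Relation.Binary.PropositionalEquality
open import Relation.Nullary using (¬_; yes; no)
open import Relation.Nullary.Decidable using (T?)

open Equivalence using (to; from)

𝟙 : Bool → ℕ
𝟙 b = if b then 1 else 0

¬T⇒𝟙≡0 : ∀ {b} → ¬ T b → 𝟙 b ≡ 0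
¬T⇒𝟙≡0 {false} _   = refl
¬T⇒𝟙≡0 {true}  ¬tt = ⊥-elim (¬tt tt)

𝟙-mono : ∀ {x y} → (T x → T y) → 𝟙 x ≤ 𝟙 y
𝟙-mono {false}         _   = z≤n
𝟙-mono {true}  {true}  _   = ≤-refl
𝟙-mono {true}  {false} x⇒y = ⊥-elim (x⇒y tt)

𝟙-< : ∀ {x y} → ¬ T x → T y → 𝟙 x < 𝟙 y
𝟙-< {x} {true} ¬x _ rewrite ¬T⇒𝟙≡0 ¬x = s≤s z≤n

𝟙≤1 : ∀ b → 𝟙 b ≤ 1
𝟙≤1 false = z≤n
𝟙≤1 true  = ≤-refl

T-not : ∀ {b} → T (not b) ⇔ (¬ T b)
T-not {false} = mk⇔ (λ _ ()) (λ _ → tt)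
T-not {true}  = mk⇔ (λ ())   (λ ¬tt → ¬tt tt)

T-<ᵇ : ∀ {x y} → T (x <ᵇ y) ⇔ (x < y)
T-<ᵇ {x} {y} = mk⇔ (<ᵇ⇒< x y) <⇒<ᵇ

T-≤ᵇ : ∀ {x y} → T (x ≤ᵇ y) ⇔ (x ≤ y)
T-≤ᵇ {x} {y} = mk⇔ (≤ᵇ⇒≤ x y) ≤⇒≤ᵇ

T-≡ᵇ : ∀ {x y} → T (x ≡ᵇ y) ⇔ (x ≡ y)
T-≡ᵇ {x} {y} = mk⇔ (≡ᵇ⇒≡ x y) (≡⇒≡ᵇ x y)

_⊆ᵇ_ : ∀ {n} → (Fin n → Bool) → (Fin n → Bool) → Set
f ⊆ᵇ g = ∀ j → T (f j) → T (g j)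

countFin≡sum : ∀ n (f : Fin n → Bool) → countFin n f ≡ sum (𝟙 ∘ f)
countFin≡sum zero    f = refl
countFin≡sum (suc n) f = cong (𝟙 (f fz) +_) (countFin≡sum n (f ∘ fs))

countFin-mono : ∀ n {f g : Fin n → Bool} → f ⊆ᵇ g → countFin n f ≤ countFin n g
countFin-mono zero    f⊆g = z≤n
countFin-mono (suc n) f⊆g = +-mono-≤ (𝟙-mono (f⊆g fz)) (countFin-mono n (f⊆g ∘ fs))

countFin-mono-< : ∀ n {f g : Fin n → Bool} (z : Fin n) →
  f ⊆ᵇ g → ¬ T (f z) → T (g z) → countFin n f < countFin n g
countFin-mono-< (suc n) fz     f⊆g ¬fz gz =
  +-mono-<-≤ (𝟙-< ¬fz gz) (countFin-mono n (f⊆g ∘ fs))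
countFin-mono-< (suc n) (fs z) f⊆g ¬fz gz =
  +-mono-≤-< (𝟙-mono (f⊆g fz)) (countFin-mono-< n z (f⊆g ∘ fs) ¬fz gz)

countFin-empty : ∀ n {f : Fin n → Bool} → (∀ j → ¬ T (f j)) → countFin n f ≡ 0
countFin-empty zero    _    = refl
countFin-empty (suc n) none rewrite ¬T⇒𝟙≡0 (none fz) = countFin-empty n (none ∘ fs)

countFin-≤-suc : ∀ n {f g : Fin n → Bool} (z : Fin n) →
  (∀ j → T (g j) → T (f j) ⊎ j ≡ z) → countFin n g ≤ suc (countFin n f)
countFin-≤-suc (suc n) {f} {g} fz g⊆f∪z =
  ≤-trans (+-mono-≤ (𝟙≤1 (g fz)) (countFin-mono n g⊆f))
          (s≤s (m≤n+m _ (𝟙 (f fz))))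
  where
  g⊆f : (g ∘ fs) ⊆ᵇ (f ∘ fs)
  g⊆f j gj with g⊆f∪z (fs j) gj
  ... | inj₁ fj = fj
countFin-≤-suc (suc n) {f} {g} (fs z) g⊆f∪z =
  ≤-trans (+-mono-≤ (𝟙-mono g₀⇒f₀) (countFin-≤-suc n z g⊆f∪z′))
          (≤-reflexive (+-suc (𝟙 (f fz)) _))
  where
  g₀⇒f₀ : T (g fz) → T (f fz)
  g₀⇒f₀ g₀ with g⊆f∪z fz g₀
  ... | inj₁ f₀ = f₀
  g⊆f∪z′ : ∀ j → T (g (fs j)) → T (f (fs j)) ⊎ j ≡ z
  g⊆f∪z′ j gj with g⊆f∪z (fs j) gj
  ... | inj₁ fj   = inj₁ fj
  ... | inj₂ refl = inj₂ refl

sum-+-countFin : ∀ n {x y : Fin n → ℕ} (c : Fin n → Bool) →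
  (∀ j → x j ≡ y j + 𝟙 (c j)) → sum x ≡ sum y + countFin n c
sum-+-countFin n {x} {y} c x≡y+c = begin
  sum x                      ≡⟨ sum-cong-≗ x≡y+c ⟩
  sum (λ j → y j + 𝟙 (c j))  ≡⟨ ∑-distrib-+ y (𝟙 ∘ c) ⟩
  sum y + sum (𝟙 ∘ c)        ≡⟨ cong (sum y +_) (countFin≡sum n c) ⟨
  sum y + countFin n c       ∎
  where open ≡-Reasoning

countFin-partition : ∀ n (v c : Fin n → Bool) →
  countFin n c ≡ countFin n (λ j → v j ∧ c j) + countFin n (λ j → not (v j) ∧ c j)
countFin-partition n v c = begin
  countFin n c             ≡⟨ countFin≡sum n c ⟩
  sum (𝟙 ∘ c)              ≡⟨ sum-+-countFin n c-out (λ j → 𝟙-partition (v j) (c j)) ⟩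
  sum (𝟙 ∘ c-in) + #c-out  ≡⟨ cong (_+ #c-out) (countFin≡sum n c-in) ⟨
  #c-in + #c-out           ∎
  where
  open ≡-Reasoning
  c-in c-out : Fin n → Bool
  c-in  j = v j ∧ c j
  c-out j = not (v j) ∧ c j
  #c-in  = countFin n c-in
  #c-out = countFin n c-out
  𝟙-partition : ∀ x y → 𝟙 y ≡ 𝟙 (x ∧ y) + 𝟙 (not x ∧ y)
  𝟙-partition false y = refl
  𝟙-partition true  y = sym (+-identityʳ (𝟙 y))

sum≡0⇒≡0 : ∀ {n} (x : Fin n → ℕ) → sum x ≡ 0 → ∀ j → x j ≡ 0
sum≡0⇒≡0 x eq fz     = m+n≡0⇒m≡0 (x fz) eq
sum≡0⇒≡0 x eq (fs j) = sum≡0⇒≡0 (x ∘ fs) (m+n≡0⇒n≡0 (x fz) eq) j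

countBelow-+ : ∀ t k f → countBelow (t + k) f ≤ countBelow t f + k
countBelow-+ t zero    f rewrite +-identityʳ t = m≤m+n _ 0
countBelow-+ t (suc k) f rewrite +-suc t k = begin
  countBelow (t + k) f + 𝟙 (f (t + k)) ≤⟨ +-mono-≤ (countBelow-+ t k f) (𝟙≤1 (f (t + k))) ⟩
  countBelow t f + k + 1               ≡⟨ +-assoc (countBelow t f) k 1 ⟩
  countBelow t f + (k + 1)             ≡⟨ cong (countBelow t f +_) (+-comm k 1) ⟩
  countBelow t f + suc k               ∎
  where open ≤-Reasoning

countBelow-none : ∀ t {f} → (∀ s → s < t → ¬ T (f s)) → countBelow t f ≡ 0
countBelow-none zero    _    = refl
countBelow-none (suc t) none rewrite ¬T⇒𝟙≡0 (none t ≤-refl) =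
  trans (+-identityʳ _) (countBelow-none t (λ s s<t → none s (m≤n⇒m≤1+n s<t)))

module _ {a ℓ₁ ℓ₂} {A : Set a} {_≈_ : A → A → Set ℓ₁} {_≼_ : A → A → Set ℓ₂}
         (≼-isTotalPreorder : IsTotalPreorder _≈_ _≼_) where

  open IsTotalPreorder ≼-isTotalPreorder using (total) renaming (refl to ≼-refl; trans to ≼-trans)

  minimiser : ∀ n (Y : Fin n → Bool) (g : Fin n → A) →
    (∀ j → ¬ T (Y j)) ⊎ ∃ λ z → T (Y z) × (∀ j → T (Y j) → g z ≼ g j)
  minimiser zero    Y g = inj₁ λ ()
  minimiser (suc n) Y g with T? (Y fz) | minimiser n (Y ∘ fs) (g ∘ fs)
  ... | no ¬y₀ | inj₁ none            = inj₁ λ { fz → ¬y₀ ; (fs j) → none j }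
  ... | no ¬y₀ | inj₂ (z , yz , least) =
    inj₂ (fs z , yz , λ { fz y₀ → ⊥-elim (¬y₀ y₀) ; (fs j) → least j })
  ... | yes y₀ | inj₁ none            =
    inj₂ (fz , y₀ , λ { fz _ → ≼-refl ; (fs j) yj → ⊥-elim (none j yj) })
  ... | yes y₀ | inj₂ (z , yz , least) with total (g fz) (g (fs z))
  ...   | inj₁ g₀≼ = inj₂ (fz , y₀ , λ { fz _ → ≼-refl ; (fs j) yj → ≼-trans g₀≼ (least j yj) })
  ...   | inj₂ ≼g₀ = inj₂ (fs z , yz , λ { fz _ → ≼g₀ ; (fs j) → least j })

module Ranking {n : ℕ} (Y : Fin n → Bool) (_≺_ : Fin n → Fin n → Bool)
  (≺-irrefl : ∀ i → ¬ T (i ≺ i))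
  (≺-trans : ∀ {i j k} → T (i ≺ j) → T (j ≺ k) → T (i ≺ k))
  (≺-connex : ∀ {i j} → i ≢ j → T (i ≺ j) ⊎ T (j ≺ i))
  (m : ℕ) where

  rank : Fin n → ℕ
  rank z = countFin n (λ i → Y i ∧ i ≺ z)

  selected : Fin n → Bool
  selected z = Y z ∧ (rank z <ᵇ m)

  rank-< : ∀ {y z} → T (Y y) → T (y ≺ z) → rank y < rank z
  rank-< {y} {z} Yy y≺z = countFin-mono-< n y below-y⊆below-z ¬y≺y (from T-∧ (Yy , y≺z))
    where
    below-y⊆below-z : ∀ i → T (Y i ∧ i ≺ y) → T (Y i ∧ i ≺ z)
    below-y⊆below-z i h with to T-∧ h
    ... | Yi , i≺y = from T-∧ (Yi , ≺-trans i≺y y≺z)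
    ¬y≺y : ¬ T (Y y ∧ y ≺ y)
    ¬y≺y = ≺-irrefl y ∘ proj₂ ∘ to T-∧

  selected-count≤ : countFin n selected ≤ m
  selected-count≤ with minimiser (Flip.isTotalPreorder ≤-isTotalPreorder) n selected rank
  ... | inj₁ none = ≤-reflexive (countFin-empty n none) ⟨ ≤-trans ⟩ z≤n
  ... | inj₂ (z , sel-z , rank≤z) =
    countFin-≤-suc n z below-z-or-z ⟨ ≤-trans ⟩ <ᵇ⇒< (rank z) m (proj₂ (to T-∧ sel-z))
    where
    -- z has the largest rank among the selected elements, so every other
    -- selected element precedes it.
    below-z-or-z : ∀ j → T (selected j) → T (Y j ∧ j ≺ z) ⊎ j ≡ z
    below-z-or-z j sel-j with j ≟ᶠ z
    ... | yes j≡z = inj₂ j≡z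
    ... | no  j≢z with ≺-connex j≢z
    ...   | inj₁ j≺z = inj₁ (from T-∧ (proj₁ (to T-∧ sel-j) , j≺z))
    ...   | inj₂ z≺j = ⊥-elim (<⇒≱ (rank-< (proj₁ (to T-∧ sel-z)) z≺j) (rank≤z j sel-j))

  selected-saturates : (Q : Fin n → Bool) →
    (∀ {i z} → T (Y i) → T (i ≺ z) → T (Y z) → T (Q z) → T (Q i)) →
    m ≤ countFin n (λ j → selected j ∧ Q j) ⊎
    countFin n (λ j → Y j ∧ Q j) ≤ countFin n (λ j → selected j ∧ Q j)
  selected-saturates Q Q-downward
    with minimiser ≤-isTotalPreorder n (λ j → (Y j ∧ Q j) ∧ (m ≤ᵇ rank j)) rank
  ... | inj₁ none = inj₂ (countFin-mono n Q⊆selected)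
    where
    Q⊆selected : ∀ j → T (Y j ∧ Q j) → T (selected j ∧ Q j)
    Q⊆selected j YQj with to (T-∧ {Y j} {Q j}) YQj
    ... | Yj , Qj = from (T-∧ {selected j}) (from (T-∧ {Y j}) (Yj , <⇒<ᵇ rank-j<m) , Qj)
      where
      rank-j<m : rank j < m
      rank-j<m = ≰⇒> λ m≤rank-j → none j (from (T-∧ {Y j ∧ Q j}) (YQj , ≤⇒≤ᵇ m≤rank-j))
  ... | inj₂ (z , h , least) with to T-∧ h
  ...   | YQz , m≤rank-z with to T-∧ YQz
  ...     | Yz , Qz = inj₁ (≤ᵇ⇒≤ m (rank z) m≤rank-z ⟨ ≤-trans ⟩ countFin-mono n below-z⊆selected)
    where
    -- z is a Q-element of least rank among the unselected ones, so all its
    -- predecessors are selected Q-elements.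
    below-z⊆selected : ∀ i → T (Y i ∧ i ≺ z) → T (selected i ∧ Q i)
    below-z⊆selected i Yi≺z with to T-∧ Yi≺z
    ... | Yi , i≺z = from T-∧ (from T-∧ (Yi , <⇒<ᵇ rank-i<m) , Qi)
      where
      Qi = Q-downward Yi i≺z Yz Qz
      rank-i<m : rank i < m
      rank-i<m = ≰⇒> λ m≤rank-i →
        <⇒≱ (rank-< Yi i≺z) (least i (from T-∧ (from T-∧ (Yi , Qi) , ≤⇒≤ᵇ m≤rank-i)))

lexᵇ : ℕ → ℕ → Bool → Bool
lexᵇ x y b = (x <ᵇ y) ∨ ((x ≡ᵇ y) ∧ b)

T-lexᵇ : ∀ x y {b} {B : Set} → T b ⇔ B → T (lexᵇ x y b) ⇔ (x < y ⊎ (x ≡ y × B))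
T-lexᵇ x y {b} T-b =
  ⇔-trans (T-∨ {x <ᵇ y}) (T-<ᵇ ⊎-⇔ ⇔-trans (T-∧ {x ≡ᵇ y} {b}) (T-≡ᵇ ×-⇔ T-b))

_<ₗₑₓ_ : ℕ × ℕ × ℕ → ℕ × ℕ × ℕ → Set
_<ₗₑₓ_ = ×-Lex _≡_ _<_ (×-Lex _≡_ _<_ _<_)

<ₗₑₓ-isStrictTotalOrder : IsStrictTotalOrder (Pointwise _≡_ (Pointwise _≡_ _≡_)) _<ₗₑₓ_
<ₗₑₓ-isStrictTotalOrder = ×-isStrictTotalOrder <-isStrictTotalOrder
  (×-isStrictTotalOrder <-isStrictTotalOrder <-isStrictTotalOrder)

module Priority {n : ℕ} (I : Instance n) (t : ℕ) (rem : Fin n → ℕ) where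

  priority : Fin n → ℕ × ℕ × ℕ
  priority j = laxity I t rem j , r (I j) , toℕ j

  T-precedes : ∀ {i j} → T (precedes I t rem i j) ⇔ (priority i <ₗₑₓ priority j)
  T-precedes {i} {j} =
    T-lexᵇ (laxity I t rem i) (laxity I t rem j) (T-lexᵇ (r (I i)) (r (I j)) T-<ᵇ)

  open IsStrictTotalOrder <ₗₑₓ-isStrictTotalOrder using (irrefl; compare)
    renaming (trans to <ₗₑₓ-trans)

  precedes-irrefl : ∀ i → ¬ T (precedes I t rem i i)
  precedes-irrefl i = irrefl (refl , refl , refl) ∘ to T-precedes

  precedes-trans : ∀ {i j k} → T (precedes I t rem i j) → T (precedes I t rem j k) →
    T (precedes I t rem i k)
  precedes-trans i≺j j≺k = from T-precedes (<ₗₑₓ-trans (to T-precedes i≺j) (to T-precedes j≺k))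

  precedes-connex : ∀ {i j} → i ≢ j → T (precedes I t rem i j) ⊎ T (precedes I t rem j i)
  precedes-connex {i} {j} i≢j with compare (priority i) (priority j)
  ... | tri< i<j _ _         = inj₁ (from T-precedes i<j)
  ... | tri> _ _ j<i         = inj₂ (from T-precedes j<i)
  ... | tri≈ _ (_ , _ , e) _ = ⊥-elim (i≢j (toℕ-injective e))

  precedes⇒laxity≤ : ∀ {i j} → T (precedes I t rem i j) → laxity I t rem i ≤ laxity I t rem j
  precedes⇒laxity≤ i≺j with to T-precedes i≺j
  ... | inj₁ lax<         = <⇒≤ lax<
  ... | inj₂ (lax≡ , _)   = ≤-reflexive lax≡

  precedes⇒rem≥ : ∀ {i j} → d (I i) ≡ d (I j) → t + rem j ≤ d (I j) →
    T (precedes I t rem i j) → rem j ≤ rem i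
  precedes⇒rem≥ {i} {j} d≡ t+rem≤d i≺j =
    +-cancelˡ-≤ t _ _ (∸-cancelʳ-≤ t+rem≤d
      (subst (λ e → e ∸ (t + rem i) ≤ d (I j) ∸ (t + rem j)) d≡ (precedes⇒laxity≤ i≺j)))

module LLFRanking {n : ℕ} (I : Instance n) (k t : ℕ) (rem : Fin n → ℕ) =
  Ranking (available I t rem) (precedes I t rem)
    (Priority.precedes-irrefl I t rem) (Priority.precedes-trans I t rem)
    (Priority.precedes-connex I t rem) k

T-available : ∀ {n} (I : Instance n) t (rem : Fin n → ℕ) j →
  T (available I t rem j) ⇔ (r (I j) ≤ t × 1 ≤ rem j × t + rem j ≤ d (I j))
T-available I t rem j =
  ⇔-trans (T-∧ {r (I j) ≤ᵇ t}) (T-≤ᵇ ×-⇔ ⇔-trans (T-∧ {1 ≤ᵇ rem j}) (T-≤ᵇ ×-⇔ T-≤ᵇ))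

selected⇒available : ∀ {n} (I : Instance n) k t (rem : Fin n → ℕ) j →
  T (select I k t rem j) → T (available I t rem j)
selected⇒available I k t rem j = proj₁ ∘ to (T-∧ {available I t rem j})

selected⇒in-window : ∀ {n} (I : Instance n) k t (rem : Fin n → ℕ) j →
  T (select I k t rem j) → r (I j) ≤ t × t < d (I j)
selected⇒in-window I k t rem j sel
  with to (T-available I t rem j) (selected⇒available I k t rem j sel)
... | r≤t , 1≤rem , t+rem≤d =
  r≤t , (≤-reflexive (+-comm 1 t) ⟨ ≤-trans ⟩ +-monoʳ-≤ t 1≤rem ⟨ ≤-trans ⟩ t+rem≤d)

llf-work-conservation : ∀ {n} (I : Instance n) k t j →
  countBelow t (λ s → llf I k s j) + llfRem I k t j ≡ p (I j)
llf-work-conservation I k zero    j = refl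
llf-work-conservation I k (suc t) j =
  trans (serve-step (llf I k t j) 1≤rem) (llf-work-conservation I k t j)
  where
  c   = countBelow t (λ s → llf I k s j)
  rem = llfRem I k t j
  1≤rem : T (llf I k t j) → 1 ≤ rem
  1≤rem = proj₁ ∘ proj₂ ∘ to (T-available I t (llfRem I k t) j)
        ∘ selected⇒available I k t (llfRem I k t) j
  serve-step : ∀ b → (T b → 1 ≤ rem) → c + 𝟙 b + (rem ∸ 𝟙 b) ≡ c + rem
  serve-step false _       = cong (_+ rem) (+-identityʳ c)
  serve-step true  pending = trans (+-assoc c 1 (rem ∸ 1)) (cong (c +_) (m+[n∸m]≡n (pending tt)))

-- Truncated workloads

excess : ∀ {n} → (Fin n → ℕ) → ℕ → ℕ
excess x h = sum (λ j → x j ∸ h)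

exceeds : ∀ {n} → (Fin n → ℕ) → ℕ → Fin n → Bool
exceeds x h j = h <ᵇ x j

∸-suc-split : ∀ x h → x ∸ h ≡ x ∸ suc h + 𝟙 (h <ᵇ x)
∸-suc-split zero    zero    = refl
∸-suc-split zero    (suc h) = refl
∸-suc-split (suc x) zero    = +-comm 1 x
∸-suc-split (suc x) (suc h) = ∸-suc-split x h

excess-level : ∀ {n} (x : Fin n → ℕ) (v : Fin n → Bool) h →
  excess x h ≡ excess x (suc h) + countFin n (λ j → v j ∧ exceeds x h j)
                                + countFin n (λ j → not (v j) ∧ exceeds x h j)
excess-level {n} x v h = begin
  excess x h                                ≡⟨ sum-+-countFin n above (λ j → ∸-suc-split (x j) h) ⟩
  excess x (suc h) + countFin n above
    ≡⟨ cong (excess x (suc h) +_) (countFin-partition n v above) ⟩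
  excess x (suc h) + (above-in + above-out) ≡⟨ +-assoc (excess x (suc h)) above-in above-out ⟨
  excess x (suc h) + above-in + above-out   ∎
  where
  open ≡-Reasoning
  above     = exceeds x h
  above-in  = countFin n (λ j → v j ∧ exceeds x h j)
  above-out = countFin n (λ j → not (v j) ∧ exceeds x h j)

excess-serve : ∀ {n} (x : Fin n → ℕ) (s : Fin n → Bool) h →
  excess x h ≡ excess (λ j → x j ∸ 𝟙 (s j)) h + countFin n (λ j → s j ∧ exceeds x h j)
excess-serve {n} x s h = sum-+-countFin n _ (λ j → serve-split (s j) (x j))
  where
  serve-split : ∀ b y → y ∸ h ≡ y ∸ 𝟙 b ∸ h + 𝟙 (b ∧ (h <ᵇ y))
  serve-split false y = sym (+-identityʳ (y ∸ h))
  serve-split true  y = trans (∸-suc-split y h) (cong (_+ 𝟙 (h <ᵇ y)) (sym (∸-+-assoc y 1 h)))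

excess≡0⇒≤ : ∀ {n} (x : Fin n → ℕ) {h} → excess x h ≡ 0 → ∀ j → x j ≤ h
excess≡0⇒≤ x eq j = m∸n≡0⇒m≤n (sum≡0⇒≡0 _ eq j)

≤⇒excess≡0 : ∀ {n} (x : Fin n → ℕ) {h} → (∀ j → x j ≤ h) → excess x h ≡ 0
≤⇒excess≡0 {n} x x≤h = trans (sum-cong-≗ (m≤n⇒m∸n≡0 ∘ x≤h)) (sum-replicate-zero n)

-- LLF against a feasible schedule, under a common deadline D

module UniformDeadlineLLF {n : ℕ} (I : Instance n) (m D : ℕ) (deadline : ∀ j → d (I j) ≡ D)
  (S : Schedule n) (S-feasible : Feasible I m S) where

  open Feasible S-feasible

  rem : ℕ → Fin n → ℕ
  rem = llfRem I m

  opt : ℕ → Fin n → ℕ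
  opt t j = p (I j) ∸ countBelow t (λ s → S s j)

  Dominated : ℕ → Set
  Dominated t = ∀ h → excess (rem t) h ≤ excess (opt t) h

  opt≤D∸t : ∀ {t} j → t ≤ D → opt t j ≤ D ∸ t
  opt≤D∸t {t} j t≤D = begin
    p (I j) ∸ c                     ≡⟨ cong (_∸ c) (amount j) ⟨
    countBelow (d (I j)) f ∸ c      ≡⟨ cong (λ e → countBelow e f ∸ c) (deadline j) ⟩
    countBelow D f ∸ c              ≡⟨ cong (λ e → countBelow e f ∸ c) (m+[n∸m]≡n t≤D) ⟨
    countBelow (t + (D ∸ t)) f ∸ c  ≤⟨ ∸-monoˡ-≤ c (countBelow-+ t (D ∸ t) f) ⟩
    c + (D ∸ t) ∸ c                 ≡⟨ m+n∸m≡n c (D ∸ t) ⟩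
    D ∸ t                           ∎
    where
    open ≤-Reasoning
    f = λ s → S s j
    c = countBelow t f

  -- S still has to finish every job by D, so its remaining work lies below
  -- level D − t; domination transfers this to LLF as non-negative laxity.
  dominated⇒laxity : ∀ {t} → t ≤ D → Dominated t → ∀ j → t + rem t j ≤ D
  dominated⇒laxity {t} t≤D dom j = begin
    t + rem t j  ≤⟨ +-monoʳ-≤ t (excess≡0⇒≤ (rem t) rem-excess≡0 j) ⟩
    t + (D ∸ t)  ≡⟨ m+[n∸m]≡n t≤D ⟩
    D            ∎
    where
    open ≤-Reasoning
    rem-excess≡0 : excess (rem t) (D ∸ t) ≡ 0
    rem-excess≡0 = n≤0⇒n≡0 (dom (D ∸ t) ⟨ ≤-trans ⟩
      ≤-reflexive (≤⇒excess≡0 (opt t) (λ i → opt≤D∸t i t≤D)))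

  dominated⇒available : ∀ {t} → t ≤ D → Dominated t → ∀ j →
    r (I j) ≤ t → 1 ≤ rem t j → T (available I t (rem t) j)
  dominated⇒available {t} t≤D dom j r≤t 1≤rem = from (T-available I t (rem t) j)
    (r≤t , 1≤rem , subst (t + rem t j ≤_) (sym (deadline j)) (dominated⇒laxity t≤D dom j))

  rem-unreleased : ∀ {t} j → t ≤ r (I j) → rem t j ≡ p (I j)
  rem-unreleased {zero}  j _   = refl
  rem-unreleased {suc t} j t<r =
    trans (cong (rem t j ∸_) (¬T⇒𝟙≡0 not-selected)) (rem-unreleased j (<⇒≤ t<r))
    where
    not-selected : ¬ T (llf I m t j)
    not-selected = <⇒≱ t<r ∘ proj₁ ∘ selected⇒in-window I m t (rem t) j

  S-unreleased : ∀ {t} j → t < r (I j) → ¬ T (S t j)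
  S-unreleased j t<r = <⇒≱ t<r ∘ proj₁ ∘ window _ j ∘ to T-≡

  opt-suc : ∀ t j → opt (suc t) j ≡ opt t j ∸ 𝟙 (S t j)
  opt-suc t j = sym (∸-+-assoc (p (I j)) (countBelow t (λ s → S s j)) (𝟙 (S t j)))

  opt-unreleased : ∀ {t} j → t ≤ r (I j) → opt t j ≡ p (I j)
  opt-unreleased {t} j t≤r =
    cong (p (I j) ∸_) (countBelow-none t (λ s s<t → S-unreleased j (<-≤-trans s<t t≤r)))

  module Step {t} (t<D : t < D) (dom : Dominated t) (h : ℕ) where

    open Priority I t (rem t) using (precedes⇒rem≥)
    open LLFRanking I m t (rem t) using (selected-saturates)

    served waiting blocked served* idle* : ℕ
    served  = countFin n (λ j → llf I m t j ∧ exceeds (rem t) h j)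
    waiting = countFin n (λ j → available I t (rem t) j ∧ exceeds (rem t) h j)
    blocked = countFin n (λ j → not (available I t (rem t) j) ∧ exceeds (rem t) h j)
    served* = countFin n (λ j → S t j ∧ exceeds (opt t) h j)
    idle*   = countFin n (λ j → not (S t j) ∧ exceeds (opt t) h j)

    llf-serve : excess (rem t) h ≡ excess (rem (suc t)) h + served
    llf-serve = excess-serve (rem t) (llf I m t) h

    opt-serve : excess (opt t) h ≡ excess (opt (suc t)) h + served*
    opt-serve = trans (excess-serve (opt t) (S t) h)
      (cong (_+ served*) (sum-cong-≗ (cong (_∸ h) ∘ sym ∘ opt-suc t)))

    llf-level : excess (rem t) h ≡ excess (rem t) (suc h) + waiting + blocked
    llf-level = excess-level (rem t) (available I t (rem t)) h

    opt-level : excess (opt t) h ≡ excess (opt t) (suc h) + served* + idle*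
    opt-level = excess-level (opt t) (S t) h

    served*≤m : served* ≤ m
    served*≤m = countFin-mono n (λ j → proj₁ ∘ to (T-∧ {S t j})) ⟨ ≤-trans ⟩ capacity t

    exceeds-downward : ∀ {i z} → T (available I t (rem t) i) → T (precedes I t (rem t) i z) →
      T (available I t (rem t) z) → T (exceeds (rem t) h z) → T (exceeds (rem t) h i)
    exceeds-downward {i} {z} _ i≺z av-z h<rem-z = <⇒<ᵇ (<ᵇ⇒< h (rem t z) h<rem-z ⟨ <-≤-trans ⟩
      precedes⇒rem≥ (trans (deadline i) (sym (deadline z)))
                    (proj₂ (proj₂ (to (T-available I t (rem t) z) av-z))) i≺z)

    -- An unavailable job above level h has positive remaining work and, by
    -- the invariant, non-negative laxity; so it is unreleased and untouched.
    blocked≤idle* : blocked ≤ idle*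
    blocked≤idle* = countFin-mono n blocked⊆idle*
      where
      blocked⊆idle* : ∀ j → T (not (available I t (rem t) j) ∧ exceeds (rem t) h j) →
        T (not (S t j) ∧ exceeds (opt t) h j)
      blocked⊆idle* j bl with to T-∧ bl | r (I j) ≤? t
      ... | unavailable , h<rem | yes r≤t = ⊥-elim (to T-not unavailable
        (dominated⇒available (<⇒≤ t<D) dom j r≤t (≤-trans (s≤s z≤n) (<ᵇ⇒< h (rem t j) h<rem))))
      ... | _ , h<rem | no r≰t =
        from T-∧ (from T-not (S-unreleased j t<r) , subst (T ∘ (h <ᵇ_)) rem≡opt h<rem)
        where
        t<r = ≰⇒> r≰t
        rem≡opt = trans (rem-unreleased j (<⇒≤ t<r)) (sym (opt-unreleased j (<⇒≤ t<r)))

    dominated-next : excess (rem (suc t)) h ≤ excess (opt (suc t)) h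
    dominated-next with selected-saturates (exceeds (rem t) h) exceeds-downward
    ... | inj₁ m≤served = +-cancelʳ-≤ served _ _ (begin
      excess (rem (suc t)) h + served  ≡⟨ llf-serve ⟨
      excess (rem t) h                 ≤⟨ dom h ⟩
      excess (opt t) h                 ≡⟨ opt-serve ⟩
      excess (opt (suc t)) h + served* ≤⟨ +-monoʳ-≤ _ (served*≤m ⟨ ≤-trans ⟩ m≤served) ⟩
      excess (opt (suc t)) h + served  ∎)
      where open ≤-Reasoning
    ... | inj₂ waiting≤served = +-cancelʳ-≤ served _ _ (begin
      excess (rem (suc t)) h + served             ≡⟨ llf-serve ⟨
      excess (rem t) h                            ≡⟨ llf-level ⟩
      excess (rem t) (suc h) + waiting + blocked
        ≤⟨ +-mono-≤ (+-mono-≤ (dom (suc h)) waiting≤served) blocked≤idle* ⟩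
      excess (opt t) (suc h) + served + idle*     ≡⟨ xy∙z≈xz∙y _ served idle* ⟩
      excess (opt t) (suc h) + idle* + served     ≡⟨ cong (_+ served) opt-next ⟨
      excess (opt (suc t)) h + served             ∎)
      where
      open ≤-Reasoning
      opt-next : excess (opt (suc t)) h ≡ excess (opt t) (suc h) + idle*
      opt-next = +-cancelʳ-≡ served* _ _ (begin-equality
        excess (opt (suc t)) h + served*        ≡⟨ opt-serve ⟨
        excess (opt t) h                        ≡⟨ opt-level ⟩
        excess (opt t) (suc h) + served* + idle* ≡⟨ xy∙z≈xz∙y _ served* idle* ⟩
        excess (opt t) (suc h) + idle* + served* ∎)

  dominated : ∀ t → t ≤ D → Dominated t
  dominated zero    _   h = ≤-refl
  dominated (suc t) t<D = Step.dominated-next t<D (dominated t (<⇒≤ t<D))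

  llf-finishes : ∀ j → rem D j ≡ 0
  llf-finishes j =
    n≤0⇒n≡0 (+-cancelˡ-≤ D _ 0 (dominated⇒laxity ≤-refl (dominated D ≤-refl) j
      ⟨ ≤-trans ⟩ ≤-reflexive (sym (+-identityʳ D))))

  llf-processes-all : ∀ j → countBelow D (λ s → llf I m s j) ≡ p (I j)
  llf-processes-all j = begin
    w             ≡⟨ +-identityʳ w ⟨
    w + 0         ≡⟨ cong (w +_) (llf-finishes j) ⟨
    w + rem D j   ≡⟨ llf-work-conservation I m D j ⟩
    p (I j)       ∎
    where
    open ≡-Reasoning
    w = countBelow D (λ s → llf I m s j)

  llf-feasible : Feasible I m (llf I m)
  llf-feasible = record
    { capacity = λ t → LLFRanking.selected-count≤ I m t (rem t)
    ; window   = λ t j sel → selected⇒in-window I m t (rem t) j (from T-≡ sel)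
    ; amount   = λ j → subst (λ e → countBelow e (λ s → llf I m s j) ≡ p (I j))
                             (sym (deadline j)) (llf-processes-all j)
    }

theorem14 : ∀ {n : ℕ} (I : Instance n) (m : ℕ) →
    UniformDeadline I → IsOptimal I m → Feasible I m (llf I m)
theorem14 I m (D , deadline) ((S , S-feasible) , _) =
  UniformDeadlineLLF.llf-feasible I m D deadline S S-feasible
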